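{- Let $\mathbb{K}$ be a field of characteristic zero and let $(f_n)_{n\in\mathbb{N}}$, $(g_n)_{n\in\mathbb{N}}$, $(l_n)_{n\in\mathbb{N}}$, $(m_n)_{n\in\mathbb{N}}$ be sequences of elements of $\mathbb{K}$ with $g_0\neq 0$ and $m_0\neq 0$. Put $f=\sum_{n\geq0}f_nx^n$, $g=\sum_{n\geq0}g_nx^n$, $l=\sum_{n\geq0}l_nx^n$, $m=\sum_{n\geq0}m_nx^n$. Let $(p_n(x))_{n\in\mathbb{N}}$ and $(q_n(x))_{n\in\mathbb{N}}$ be the sequences of polynomials determined by $p_0(x)=\frac{f_0}{g_0}$, $q_0(x)=\frac{l_0}{m_0}$ and, for $n\geq1$, \[ p_n(x)=\left(\frac{x-g_1}{g_0}\right)p_{n-1}(x)-\frac{g_2}{g_0}p_{n-2}(x)-\cdots-\frac{g_{n}}{g_0}p_{0}(x)+\frac{f_{n}}{g_0}, \] \[ q_n(x)=\left(\frac{x-m_1}{m_0}\right)q_{n-1}(x)-\frac{m_2}{m_0}q_{n-2}(x)-\cdots-\frac{m_{n}}{m_0}q_{0}(x)+\frac{l_{n}}{m_0}. \] Write $p_n(x)=\sum_{k=0}^np_{n,k}x^k$ and define the umbral composition $(p_n(x))_{n\in\mathbb{N}}\sharp(q_n(x))_{n\in\mathbb{N}}=(r_n(x))_{n\in\mathbb{N}}$ by $r_n(x)=\sum_{k=0}^np_{n,k}q_k(x)$ (i.e. replace each power $x^k$ in $p_n(x)$ by $q_k(x)$). Then $(r_n(x))_{n\in\mathbb{N}}$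 satisfies the recurrence \[ r_n(x)=\left(\frac{x-\alpha_1}{\alpha_0}\right)r_{n-1}(x)-\frac{\alpha_2}{\alpha_0}r_{n-2}(x)-\cdots-\frac{\alpha_{n}}{\alpha_0}r_{0}(x)+\frac{\beta_{n}}{\alpha_0}, \] where $(\alpha_n)_{n\in\mathbb{N}}$ and $(\beta_n)_{n\in\mathbb{N}}$ are the sequences defined by $f(x)\,l\!\left(\frac{x}{g(x)}\right)=\sum_{n\geq0}\beta_nx^n$ and $g(x)\,m\!\left(\frac{x}{g(x)}\right)=\sum_{n\geq0}\alpha_nx^n$.
   Context: For power series $f,g$ with $g_0\neq0$, $T(f\mid g)$ denotes the Riordan array (infinite lower triangular matrix) whose $k$-th column has generating function $\frac{f}{g}\left(\frac{x}{g}\right)^k$; the polynomials $p_n$ above have as coefficients the rows of $T(f\mid g)$, the $q_n$ those of $T(l\mid m)$, and the $r_n$ those of the product $T(f\mid g)T(l\mid m)=T\left(f\,l\left(\frac{x}{g}\right)\Big|\,g\,m\left(\frac{x}{g}\right)\right)$. -}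

module Defs where

open import Level using (_⊔_)
open import Data.Nat using (ℕ; zero; suc; _∸_)
open import Data.Product using (_×_)
open import Relation.Nullary using (¬_)
open import Relation.Binary.PropositionalEquality using (_≡_)
open import Algebra.Bundles using (CommutativeRing)
import Relation.Binary.Reasoning.Setoid as SetoidReasoning

record IsField {c ℓ} (R : CommutativeRing c ℓ) : Set (c ⊔ ℓ) where
  open CommutativeRing R
  field
    0≉1   : ¬ (0# ≈ 1#)
    inv   : (x : Carrier) → ¬ (x ≈ 0#) → Carrier
    inv-r : (x : Carrier) (p : ¬ (x ≈ 0#)) → x * inv x p ≈ 1#

module _ {c ℓ} (R : CommutativeRing c ℓ) where
  open CommutativeRing R
  natCast : ℕ → Carrier
  natCast zero    = 0#
  natCast (suc n) = 1# + natCast n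

  CharZero : Set ℓ
  CharZero = (n : ℕ) → natCast n ≈ 0# → n ≡ 0

module FieldDefs {c ℓ} (R : CommutativeRing c ℓ) (F : IsField R) where
  open CommutativeRing R
  open IsField F

  K : Set c
  K = Carrier

  -- formal power series, and polynomials, as coefficient sequences
  Series : Set c
  Series = ℕ → K

  sumTo : ℕ → (ℕ → K) → K
  sumTo zero    f = f 0
  sumTo (suc n) f = sumTo n f + f (suc n)

  sumLt : ℕ → (ℕ → K) → K
  sumLt zero    f = 0#
  sumLt (suc n) f = sumLt n f + f n

  _⊛_ : Series → Series → Series
  (a ⊛ b) n = sumTo n (λ k → a k * b (n ∸ k))

  oneS : Series
  oneS zero    = 1#
  oneS (suc _) = 0#

  X : Series
  X 1 = 1#
  X _ = 0#

  powS : Series → ℕ → Series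
  powS h zero    = oneS
  powS h (suc k) = h ⊛ powS h k

  -- multiplicative inverse of a series with invertible constant term:
  -- b 0 = c = a 0 ⁻¹,  b (n+1) = - c * Σ_{k=1}^{n+1} a k * b (n+1-k)
  -- (first argument is fuel, always sufficient at the top-level call)
  invAux : Series → K → ℕ → ℕ → K
  invAux a c zero    n       = 0#
  invAux a c (suc f) zero    = c
  invAux a c (suc f) (suc n) =
    - (c * sumTo n (λ j → a (suc j) * invAux a c f (n ∸ j)))

  invS : (a : Series) → ¬ (a 0 ≈ 0#) → Series
  invS a p n = invAux a (inv (a 0) p) (suc n) n

  -- composition l(h) for a series h with zero constant term:
  -- coefficient n of Σ_k l_k h^k (only k ≤ n contribute)
  compose : Series → Series → Series
  compose l h n = sumTo n (λ k → l k * powS h k n)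

  xOver : (g : Series) → ¬ (g 0 ≈ 0#) → Series
  xOver g p = X ⊛ invS g p

  betaS : (f g l : Series) → ¬ (g 0 ≈ 0#) → Series
  betaS f g l p = f ⊛ compose l (xOver g p)

  alphaS : (g m : Series) → ¬ (g 0 ≈ 0#) → Series
  alphaS g m p = g ⊛ compose m (xOver g p)

  -- a sequence of polynomials (p n k = coefficient of x^k in p_n)
  PolySeq : Set c
  PolySeq = ℕ → ℕ → K

  constP : K → ℕ → K
  constP a zero    = a
  constP a (suc _) = 0#

  shiftX : (ℕ → K) → ℕ → K
  shiftX P zero    = 0#
  shiftX P (suc k) = P k

  Rec : (a b : Series) → ¬ (a 0 ≈ 0#) → PolySeq → Set ℓ
  Rec a b p s =
    ((k : ℕ) → s 0 k ≈ constP (b 0 * ia) k) ×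
    ((n k : ℕ) → s (suc n) k ≈
        (((shiftX (s n) k + - (a 1 * s n k)) * ia
          + - sumLt n (λ i → (a (suc (suc i)) * ia) * s (n ∸ suc i) k))
          + constP (b (suc n) * ia) k))
    where ia = inv (a 0) p

  umbral : PolySeq → PolySeq → PolySeq
  umbral p q n j = sumTo n (λ k → p n k * q k j)

  -- α_0 = g_0 m_0 ≠ 0 (needed to divide by α_0)
  alpha0≉0 : (g m : Series) (pg : ¬ (g 0 ≈ 0#)) → ¬ (m 0 ≈ 0#) →
             ¬ (alphaS g m pg 0 ≈ 0#)
  alpha0≉0 g m pg pm eq = pm m0≈0
    where
    open SetoidReasoning setoid
    ig = inv (g 0) pg
    m0≈0 : m 0 ≈ 0#
    m0≈0 = begin
      m 0                              ≈⟨ sym (*-identityʳ (m 0)) ⟩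
      m 0 * 1#                         ≈⟨ sym (*-identityˡ _) ⟩
      1# * (m 0 * 1#)                  ≈⟨ *-congʳ (sym (trans (*-comm ig (g 0)) (inv-r (g 0) pg))) ⟩
      (ig * g 0) * (m 0 * 1#)          ≈⟨ *-assoc ig (g 0) _ ⟩
      ig * (g 0 * (m 0 * 1#))          ≈⟨ *-congˡ eq ⟩
      ig * 0#                          ≈⟨ zeroʳ ig ⟩
      0# ∎

module Submission where

-- For a polynomial sequence s write  col s k = Σₙ s n k xⁿ  for its k-th
-- coefficient column.  Multiplying the recurrence  Rec a b s  by a₀ shows that
-- it is equivalent to the column equations
--     a · col s 0 = b ,        a · col s (k+1) = x · col s k ,
-- so that  col p k = P₀ · hᵏ  with  P₀ = col p 0 = f/g  and  h = x/g: the
-- coefficients of p form the Riordan array T(f | g).  Composition with h,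
-- C u = u(h), is multiplicative.  Hence the columns of r = p ♯ q are
--     col r j = Σₖ q k j · P₀ hᵏ = P₀ · C (col q j) ,
-- and with α = g · C m, β = f · C l, g · P₀ = f and f · h = x · P₀ one gets
--     α · col r j = f · C (m · col q j) ,
-- which is β for j = 0 and x · col r (j-1) otherwise; converting these column
-- equations back yields the recurrence for r.
--
-- The theorem is assembled at the end.

open import Defs
open import Data.Nat using (ℕ; zero; suc; _∸_; _≤_; _<_; _≤′_; ≤′-refl; ≤′-step; s≤s)
open import Data.Nat.Properties using (m∸n≤m; ≤-refl; ≤-trans; n≤1+n; <-≤-trans; ≤⇒≤′; ≤′⇒≤)
open import Data.Nat.Induction using (<-rec)
open import Data.Product using (_,_)
open import Data.Maybe using (nothing)
open import Level using (_⊔_)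
open import Relation.Nullary using (¬_)
open import Algebra.Bundles using (CommutativeRing)
open import Relation.Binary.Bundles using (Setoid)
import Relation.Binary.Reasoning.Setoid as SetoidReasoning
import Tactic.RingSolver.Core.AlmostCommutativeRing as ACR

module Umbral {c ℓ} (R : CommutativeRing c ℓ) (F : IsField R) where
  open CommutativeRing R
  open IsField F
  open FieldDefs R F
  open SetoidReasoning setoid
  open import Algebra.Properties.Ring ring using (-‿distribʳ-*)
  open import Algebra.Properties.AbelianGroup +-abelianGroup using (⁻¹-∙-comm)
  open import Algebra.Properties.Group +-group using (//-rightDividesˡ; //-rightDividesʳ)
  open import Algebra.Properties.CommutativeSemigroup +-commutativeSemigroup
    using () renaming (interchange to +-interchange)
  open import Algebra.Properties.CommutativeSemigroup *-commutativeSemigroup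
    using () renaming (x∙yz≈y∙xz to *-exchange)
  open import Tactic.RingSolver.NonReflective (ACR.fromCommutativeRing R (λ _ → nothing))
    using (solve; _⊜_; _⊕_; _⊗_)

  neg-+ : ∀ x y → - (x + y) ≈ - x + - y
  neg-+ x y = sym (⁻¹-∙-comm x y)

  sumTo-cong : ∀ n {u v : ℕ → K} → (∀ k → u k ≈ v k) → sumTo n u ≈ sumTo n v
  sumTo-cong zero    e = e 0
  sumTo-cong (suc n) e = +-cong (sumTo-cong n e) (e (suc n))

  sumTo-+ : ∀ n (u v : ℕ → K) → sumTo n (λ k → u k + v k) ≈ sumTo n u + sumTo n v
  sumTo-+ zero    u v = refl
  sumTo-+ (suc n) u v = trans (+-congʳ (sumTo-+ n u v)) (+-interchange _ _ _ _)

  sumTo-*ˡ : ∀ n a (u : ℕ → K) → a * sumTo n u ≈ sumTo n (λ k → a * u k)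
  sumTo-*ˡ zero    a u = refl
  sumTo-*ˡ (suc n) a u = trans (distribˡ a _ _) (+-congʳ (sumTo-*ˡ n a u))

  sumTo-*ʳ : ∀ n a (u : ℕ → K) → sumTo n u * a ≈ sumTo n (λ k → u k * a)
  sumTo-*ʳ n a u =
    trans (*-comm _ a) (trans (sumTo-*ˡ n a u) (sumTo-cong n (λ k → *-comm a (u k))))

  sumTo-zero : ∀ n (u : ℕ → K) → (∀ k → u k ≈ 0#) → sumTo n u ≈ 0#
  sumTo-zero zero    u e = e 0
  sumTo-zero (suc n) u e = trans (+-cong (sumTo-zero n u e) (e (suc n))) (+-identityʳ 0#)

  sumTo-head : ∀ n (u : ℕ → K) → sumTo (suc n) u ≈ u 0 + sumTo n (λ k → u (suc k))
  sumTo-head zero    u = refl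
  sumTo-head (suc n) u = trans (+-congʳ (sumTo-head n u)) (+-assoc _ _ _)

  sumTo-headLt : ∀ n (u : ℕ → K) → sumTo n u ≈ u 0 + sumLt n (λ i → u (suc i))
  sumTo-headLt zero    u = sym (+-identityʳ _)
  sumTo-headLt (suc n) u = trans (+-congʳ (sumTo-headLt n u)) (+-assoc _ _ _)

  sumTo-swap : ∀ n m (G : ℕ → ℕ → K) →
    sumTo n (λ i → sumTo m (λ k → G i k)) ≈ sumTo m (λ k → sumTo n (λ i → G i k))
  sumTo-swap zero    m G = refl
  sumTo-swap (suc n) m G =
    trans (+-congʳ (sumTo-swap n m G))
          (sym (sumTo-+ m (λ k → sumTo n (λ i → G i k)) (G (suc n))))

  sumTo-extend : ∀ {n M} (u : ℕ → K) → n ≤ M → (∀ k → n < k → u k ≈ 0#) →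
                 sumTo M u ≈ sumTo n u
  sumTo-extend {n} u n≤M vanish = go (≤⇒≤′ n≤M)
    where
    go : ∀ {M} → n ≤′ M → sumTo M u ≈ sumTo n u
    go ≤′-refl          = refl
    go (≤′-step {M} le) =
      trans (+-cong (go le) (vanish (suc M) (s≤s (≤′⇒≤ le)))) (+-identityʳ _)

  sumLt-cong : ∀ n {u v : ℕ → K} → (∀ k → u k ≈ v k) → sumLt n u ≈ sumLt n v
  sumLt-cong zero    e = refl
  sumLt-cong (suc n) e = +-cong (sumLt-cong n e) (e n)

  sumLt-*ˡ : ∀ n a (u : ℕ → K) → a * sumLt n u ≈ sumLt n (λ k → a * u k)
  sumLt-*ˡ zero    a u = zeroʳ a
  sumLt-*ˡ (suc n) a u = trans (distribˡ a _ _) (+-congʳ (sumLt-*ˡ n a u))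

  conv : ℕ → (ℕ → ℕ → K) → K
  conv n G = sumTo n (λ k → G k (n ∸ k))

  conv-cong : ∀ n {G H : ℕ → ℕ → K} → (∀ i j → G i j ≈ H i j) → conv n G ≈ conv n H
  conv-cong n e = sumTo-cong n (λ k → e k (n ∸ k))

  conv-+ : ∀ n (G H : ℕ → ℕ → K) → conv n (λ i j → G i j + H i j) ≈ conv n G + conv n H
  conv-+ n G H = sumTo-+ n (λ k → G k (n ∸ k)) (λ k → H k (n ∸ k))

  conv-head : ∀ n (G : ℕ → ℕ → K) →
              conv (suc n) G ≈ G 0 (suc n) + conv n (λ i j → G (suc i) j)
  conv-head n G = sumTo-head n (λ k → G k (suc n ∸ k))

  conv-last : ∀ n (G : ℕ → ℕ → K) →
              conv (suc n) G ≈ conv n (λ i j → G i (suc j)) + G (suc n) 0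
  conv-last zero    G = refl
  conv-last (suc n) G = begin
    conv (suc (suc n)) G
      ≈⟨ conv-head (suc n) G ⟩
    G 0 (suc (suc n)) + conv (suc n) (λ i j → G (suc i) j)
      ≈⟨ +-congˡ (conv-last n (λ i j → G (suc i) j)) ⟩
    G 0 (suc (suc n)) + (conv n (λ i j → G (suc i) (suc j)) + G (suc (suc n)) 0)
      ≈⟨ sym (+-assoc _ _ _) ⟩
    (G 0 (suc (suc n)) + conv n (λ i j → G (suc i) (suc j))) + G (suc (suc n)) 0
      ≈⟨ +-congʳ (sym (conv-head n (λ i j → G i (suc j)))) ⟩
    conv (suc n) (λ i j → G i (suc j)) + G (suc (suc n)) 0 ∎

  conv-comm : ∀ n (G : ℕ → ℕ → K) → conv n G ≈ conv n (λ i j → G j i)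
  conv-comm zero    G = refl
  conv-comm (suc n) G = begin
    conv (suc n) G                             ≈⟨ conv-head n G ⟩
    G 0 (suc n) + conv n (λ i j → G (suc i) j) ≈⟨ +-congˡ (conv-comm n (λ i j → G (suc i) j)) ⟩
    G 0 (suc n) + conv n (λ i j → G (suc j) i) ≈⟨ +-comm _ _ ⟩
    conv n (λ i j → G (suc j) i) + G 0 (suc n) ≈⟨ sym (conv-last n (λ i j → G j i)) ⟩
    conv (suc n) (λ i j → G j i)               ∎

  conv-assoc : ∀ n (G : ℕ → ℕ → ℕ → K) →
    conv n (λ i j → conv j (λ u v → G i u v)) ≈ conv n (λ s v → conv s (λ i u → G i u v))
  conv-assoc zero    G = refl
  conv-assoc (suc n) G = begin
    conv (suc n) (λ i j → conv j (λ u v → G i u v))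
      ≈⟨ conv-last n (λ i j → conv j (λ u v → G i u v)) ⟩
    conv n (λ i j → conv (suc j) (λ u v → G i u v)) + G (suc n) 0 0
      ≈⟨ +-congʳ (conv-cong n (λ i j → conv-last j (λ u v → G i u v))) ⟩
    conv n (λ i j → conv j (λ u v → G i u (suc v)) + G i (suc j) 0) + G (suc n) 0 0
      ≈⟨ +-congʳ (conv-+ n (λ i j → conv j (λ u v → G i u (suc v))) (λ i j → G i (suc j) 0)) ⟩
    (conv n (λ i j → conv j (λ u v → G i u (suc v))) + conv n (λ i j → G i (suc j) 0))
      + G (suc n) 0 0
      ≈⟨ +-congʳ (+-congʳ (conv-assoc n (λ i u v → G i u (suc v)))) ⟩
    (conv n (λ s v → conv s (λ i u → G i u (suc v))) + conv n (λ i j → G i (suc j) 0))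
      + G (suc n) 0 0
      ≈⟨ +-assoc _ _ _ ⟩
    conv n (λ s v → conv s (λ i u → G i u (suc v)))
      + (conv n (λ i j → G i (suc j) 0) + G (suc n) 0 0)
      ≈⟨ +-congˡ (sym (conv-last n (λ i u → G i u 0))) ⟩
    conv n (λ s v → conv s (λ i u → G i u (suc v))) + conv (suc n) (λ i u → G i u 0)
      ≈⟨ sym (conv-last n (λ s v → conv s (λ i u → G i u v))) ⟩
    conv (suc n) (λ s v → conv s (λ i u → G i u v)) ∎

  infix 4 _≋_
  _≋_ : Series → Series → Set ℓ
  u ≋ v = ∀ n → u n ≈ v n

  seriesSetoid : Setoid c ℓ
  seriesSetoid = record
    { Carrier       = Series
    ; _≈_           = _≋_
    ; isEquivalence = record { refl  = λ n → refl
                             ; sym   = λ e n → sym (e n)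
                             ; trans = λ e e′ n → trans (e n) (e′ n) } }

  module S = SetoidReasoning seriesSetoid
  open Setoid seriesSetoid using () renaming (sym to ≋-sym; trans to ≋-trans)

  _+ₛ_ : Series → Series → Series
  (u +ₛ v) n = u n + v n

  _·ₛ_ : K → Series → Series
  (a ·ₛ u) n = a * u n

  tail : Series → Series
  tail u k = u (suc k)

  ⊛-cong : ∀ {u u′ v v′} → u ≋ u′ → v ≋ v′ → (u ⊛ v) ≋ (u′ ⊛ v′)
  ⊛-cong eu ev n = sumTo-cong n (λ k → *-cong (eu k) (ev (n ∸ k)))

  ⊛-congˡ : ∀ u {v v′} → v ≋ v′ → (u ⊛ v) ≋ (u ⊛ v′)
  ⊛-congˡ u = ⊛-cong {u} {u} (λ n → refl)

  ⊛-congʳ : ∀ {u u′} v → u ≋ u′ → (u ⊛ v) ≋ (u′ ⊛ v)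
  ⊛-congʳ v eu = ⊛-cong {v = v} {v′ = v} eu (λ n → refl)

  ⊛-comm : ∀ u v → (u ⊛ v) ≋ (v ⊛ u)
  ⊛-comm u v n =
    trans (conv-comm n (λ i j → u i * v j)) (conv-cong n (λ i j → *-comm (u j) (v i)))

  ⊛-assoc : ∀ u v w → ((u ⊛ v) ⊛ w) ≋ (u ⊛ (v ⊛ w))
  ⊛-assoc u v w n = begin
    ((u ⊛ v) ⊛ w) n
      ≈⟨ conv-cong n (λ s j → sumTo-*ʳ s (w j) (λ k → u k * v (s ∸ k))) ⟩
    conv n (λ s j → conv s (λ i k → (u i * v k) * w j))
      ≈⟨ sym (conv-assoc n (λ i k j → (u i * v k) * w j)) ⟩
    conv n (λ i s → conv s (λ k j → (u i * v k) * w j))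
      ≈⟨ conv-cong n (λ i s → conv-cong s (λ k j → *-assoc (u i) (v k) (w j))) ⟩
    conv n (λ i s → conv s (λ k j → u i * (v k * w j)))
      ≈⟨ conv-cong n (λ i s → sym (sumTo-*ˡ s (u i) (λ k → v k * w (s ∸ k)))) ⟩
    (u ⊛ (v ⊛ w)) n ∎

  ⊛-distribˡ : ∀ u v w → (u ⊛ (v +ₛ w)) ≋ ((u ⊛ v) +ₛ (u ⊛ w))
  ⊛-distribˡ u v w n =
    trans (conv-cong n (λ i j → distribˡ (u i) (v j) (w j)))
          (conv-+ n (λ i j → u i * v j) (λ i j → u i * w j))

  ⊛-distribʳ : ∀ u v w → ((u +ₛ v) ⊛ w) ≋ ((u ⊛ w) +ₛ (v ⊛ w))
  ⊛-distribʳ u v w n =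
    trans (conv-cong n (λ i j → distribʳ (w j) (u i) (v i)))
          (conv-+ n (λ i j → u i * w j) (λ i j → v i * w j))

  ⊛-scalˡ : ∀ a u v → ((a ·ₛ u) ⊛ v) ≋ (a ·ₛ (u ⊛ v))
  ⊛-scalˡ a u v n = trans (conv-cong n (λ i j → *-assoc a (u i) (v j)))
                          (sym (sumTo-*ˡ n a (λ k → u k * v (n ∸ k))))

  ⊛-scalʳ : ∀ a u v → (u ⊛ (a ·ₛ v)) ≋ (a ·ₛ (u ⊛ v))
  ⊛-scalʳ a u v n = trans (conv-cong n (λ i j → *-exchange (u i) a (v j)))
                          (sym (sumTo-*ˡ n a (λ k → u k * v (n ∸ k))))

  oneS-⊛ : ∀ u → (oneS ⊛ u) ≋ u
  oneS-⊛ u zero    = *-identityˡ (u 0)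
  oneS-⊛ u (suc n) = begin
    (oneS ⊛ u) (suc n)                          ≈⟨ conv-head n (λ i j → oneS i * u j) ⟩
    1# * u (suc n) + conv n (λ i j → 0# * u j)  ≈⟨ +-cong (*-identityˡ _) (sumTo-zero n _ (λ k → zeroˡ _)) ⟩
    u (suc n) + 0#                              ≈⟨ +-identityʳ _ ⟩
    u (suc n)                                   ∎

  ⊛-oneS : ∀ u → (u ⊛ oneS) ≋ u
  ⊛-oneS u n = trans (⊛-comm u oneS n) (oneS-⊛ u n)

  X⊛-zero : ∀ u → (X ⊛ u) 0 ≈ 0#
  X⊛-zero u = zeroˡ (u 0)

  X⊛-suc : ∀ u n → (X ⊛ u) (suc n) ≈ u n
  X⊛-suc u zero    = trans (+-cong (zeroˡ _) (*-identityˡ _)) (+-identityˡ _)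
  X⊛-suc u (suc n) = begin
    (X ⊛ u) (suc (suc n))
      ≈⟨ conv-head (suc n) (λ i j → X i * u j) ⟩
    0# * u (suc (suc n)) + conv (suc n) (λ i j → X (suc i) * u j)
      ≈⟨ +-cong (zeroˡ _) (conv-head n (λ i j → X (suc i) * u j)) ⟩
    0# + (1# * u (suc n) + conv n (λ i j → 0# * u j))
      ≈⟨ +-identityˡ _ ⟩
    1# * u (suc n) + conv n (λ i j → 0# * u j)
      ≈⟨ +-cong (*-identityˡ _) (sumTo-zero n _ (λ k → zeroˡ _)) ⟩
    u (suc n) + 0#
      ≈⟨ +-identityʳ _ ⟩
    u (suc n) ∎

  ⊛-interchange : ∀ u v w z → ((u ⊛ v) ⊛ (w ⊛ z)) ≋ ((u ⊛ w) ⊛ (v ⊛ z))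
  ⊛-interchange u v w z = S.begin
    ((u ⊛ v) ⊛ (w ⊛ z)) S.≈⟨ ⊛-assoc u v (w ⊛ z) ⟩
    (u ⊛ (v ⊛ (w ⊛ z))) S.≈⟨ ⊛-congˡ u (≋-sym (⊛-assoc v w z)) ⟩
    (u ⊛ ((v ⊛ w) ⊛ z)) S.≈⟨ ⊛-congˡ u (⊛-congʳ z (⊛-comm v w)) ⟩
    (u ⊛ ((w ⊛ v) ⊛ z)) S.≈⟨ ⊛-congˡ u (⊛-assoc w v z) ⟩
    (u ⊛ (w ⊛ (v ⊛ z))) S.≈⟨ ≋-sym (⊛-assoc u w (v ⊛ z)) ⟩
    ((u ⊛ w) ⊛ (v ⊛ z)) S.∎

  tail-⊛ : ∀ u v → tail (u ⊛ v) ≋ ((tail u ⊛ v) +ₛ (u 0 ·ₛ tail v))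
  tail-⊛ u v k = trans (conv-head k (λ i j → u i * v j)) (+-comm _ _)

  module Inverse (a : Series) (a₀≉0 : ¬ (a 0 ≈ 0#)) where
    ia : K
    ia = inv (a 0) a₀≉0

    invAux-fuel : ∀ fuel fuel′ n → n < fuel → n < fuel′ →
                  invAux a ia fuel n ≈ invAux a ia fuel′ n
    invAux-fuel (suc _) (suc _) zero _ _ = refl
    invAux-fuel (suc (suc fuel)) (suc (suc fuel′)) (suc n) (s≤s (s≤s le)) (s≤s (s≤s le′)) =
      -‿cong (*-congˡ (sumTo-cong n (λ j → *-congˡ
        (invAux-fuel (suc fuel) (suc fuel′) (n ∸ j)
          (s≤s (≤-trans (m∸n≤m n j) le)) (s≤s (≤-trans (m∸n≤m n j) le′))))))
    invAux-fuel (suc zero) _ (suc n) (s≤s ()) _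
    invAux-fuel (suc (suc _)) (suc zero) (suc n) _ (s≤s ())

    invS-suc : ∀ n → invS a a₀≉0 (suc n) ≈
                     - (ia * sumTo n (λ j → a (suc j) * invS a a₀≉0 (n ∸ j)))
    invS-suc n = -‿cong (*-congˡ (sumTo-cong n (λ j → *-congˡ
      (invAux-fuel (suc n) (suc (n ∸ j)) (n ∸ j) (s≤s (m∸n≤m n j)) ≤-refl))))

    ⊛-invS : (a ⊛ invS a a₀≉0) ≋ oneS
    ⊛-invS zero    = inv-r (a 0) a₀≉0
    ⊛-invS (suc n) = begin
      (a ⊛ b) (suc n)          ≈⟨ conv-head n (λ i j → a i * b j) ⟩
      a 0 * b (suc n) + Σ      ≈⟨ +-congʳ (*-congˡ (invS-suc n)) ⟩
      a 0 * - (ia * Σ) + Σ     ≈⟨ +-congʳ (sym (-‿distribʳ-* (a 0) (ia * Σ))) ⟩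
      - (a 0 * (ia * Σ)) + Σ   ≈⟨ +-congʳ (-‿cong (sym (*-assoc (a 0) ia Σ))) ⟩
      - ((a 0 * ia) * Σ) + Σ   ≈⟨ +-congʳ (-‿cong (trans (*-congʳ (inv-r (a 0) a₀≉0)) (*-identityˡ Σ))) ⟩
      - Σ + Σ                  ≈⟨ -‿inverseˡ Σ ⟩
      0#                       ∎
      where
      b = invS a a₀≉0
      Σ = sumTo n (λ j → a (suc j) * b (n ∸ j))

    invS-⊛ : (invS a a₀≉0 ⊛ a) ≋ oneS
    invS-⊛ = ≋-trans (⊛-comm _ a) ⊛-invS

  module Composition (h : Series) (h₀≈0 : h 0 ≈ 0#) where
    h₀* : ∀ y → h 0 * y ≈ 0#
    h₀* y = trans (*-congʳ h₀≈0) (zeroˡ y)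

    h⊛-below : ∀ n (v v′ : Series) → (∀ j → j < n → v j ≈ v′ j) → (h ⊛ v) n ≈ (h ⊛ v′) n
    h⊛-below zero    v v′ e = trans (h₀* _) (sym (h₀* _))
    h⊛-below (suc n) v v′ e = begin
      (h ⊛ v) (suc n)                                  ≈⟨ conv-head n (λ i j → h i * v j) ⟩
      h 0 * v (suc n) + conv n (λ i j → h (suc i) * v j)
        ≈⟨ +-cong (trans (h₀* _) (sym (h₀* _)))
                  (sumTo-cong n (λ k → *-congˡ (e (n ∸ k) (s≤s (m∸n≤m n k))))) ⟩
      h 0 * v′ (suc n) + conv n (λ i j → h (suc i) * v′ j) ≈⟨ sym (conv-head n (λ i j → h i * v′ j)) ⟩
      (h ⊛ v′) (suc n)                                 ∎

    powS-vanish : ∀ k n → n < k → powS h k n ≈ 0#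
    powS-vanish (suc k) n (s≤s n≤k) =
      trans (h⊛-below n (powS h k) (λ _ → 0#)
                      (λ j j<n → powS-vanish k j (<-≤-trans j<n n≤k)))
            (sumTo-zero n _ (λ i → zeroʳ _))

    C : Series → Series
    C u = compose u h

    C-partial : ∀ u {n M} → n ≤ M → sumTo M (λ k → u k * powS h k n) ≈ C u n
    C-partial u n≤M =
      sumTo-extend _ n≤M (λ k n<k → trans (*-congˡ (powS-vanish k _ n<k)) (zeroʳ _))

    C-cong : ∀ {u u′} → u ≋ u′ → C u ≋ C u′
    C-cong e n = sumTo-cong n (λ k → *-congʳ (e k))

    C-+ : ∀ u v → C (u +ₛ v) ≋ (C u +ₛ C v)
    C-+ u v n = trans (sumTo-cong n (λ k → distribʳ _ (u k) (v k))) (sumTo-+ n _ _)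

    C-· : ∀ a u → C (a ·ₛ u) ≋ (a ·ₛ C u)
    C-· a u n = trans (sumTo-cong n (λ k → *-assoc a (u k) _)) (sym (sumTo-*ˡ n a _))

    C-horner : ∀ u n → C u n ≈ u 0 * oneS n + (h ⊛ C (tail u)) n
    C-horner u n = begin
      C u n
        ≈⟨ sym (C-partial u (n≤1+n n)) ⟩
      sumTo (suc n) (λ k → u k * powS h k n)
        ≈⟨ sumTo-head n (λ k → u k * powS h k n) ⟩
      u 0 * oneS n + sumTo n (λ k → u (suc k) * (h ⊛ powS h k) n)
        ≈⟨ +-congˡ (sumTo-cong n (λ k → sumTo-*ˡ n (u (suc k)) _)) ⟩
      u 0 * oneS n + sumTo n (λ k → sumTo n (λ i → u (suc k) * (h i * powS h k (n ∸ i))))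
        ≈⟨ +-congˡ (sumTo-cong n (λ k → sumTo-cong n (λ i → *-exchange (u (suc k)) (h i) _))) ⟩
      u 0 * oneS n + sumTo n (λ k → sumTo n (λ i → h i * (u (suc k) * powS h k (n ∸ i))))
        ≈⟨ +-congˡ (sym (sumTo-swap n n (λ i k → h i * (u (suc k) * powS h k (n ∸ i))))) ⟩
      u 0 * oneS n + sumTo n (λ i → sumTo n (λ k → h i * (u (suc k) * powS h k (n ∸ i))))
        ≈⟨ +-congˡ (sumTo-cong n (λ i → sym (sumTo-*ˡ n (h i) _))) ⟩
      u 0 * oneS n + sumTo n (λ i → h i * sumTo n (λ k → u (suc k) * powS h k (n ∸ i)))
        ≈⟨ +-congˡ (sumTo-cong n (λ i → *-congˡ (C-partial (tail u) (m∸n≤m n i)))) ⟩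
      u 0 * oneS n + (h ⊛ C (tail u)) n ∎

    C-X : ∀ u → C (X ⊛ u) ≋ (h ⊛ C u)
    C-X u n = begin
      C (X ⊛ u) n                                    ≈⟨ C-horner (X ⊛ u) n ⟩
      (X ⊛ u) 0 * oneS n + (h ⊛ C (tail (X ⊛ u))) n  ≈⟨ +-cong (trans (*-congʳ (X⊛-zero u)) (zeroˡ _))
                                                                (⊛-congˡ h (C-cong (X⊛-suc u)) n) ⟩
      0# + (h ⊛ C u) n                               ≈⟨ +-identityˡ _ ⟩
      (h ⊛ C u) n                                    ∎

    C-MultAt : ℕ → Set (c ⊔ ℓ)
    C-MultAt n = ∀ u v → C (u ⊛ v) n ≈ (C u ⊛ C v) n

    -- Expand both sides by Horner's rule; by h⊛-below the remaining
    -- products need multiplicativity only in degrees below n.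
    C-mult-step : ∀ n → (∀ {j} → j < n → C-MultAt j) → C-MultAt n
    C-mult-step n ih u v = begin
      C (u ⊛ v) n
        ≈⟨ C-horner (u ⊛ v) n ⟩
      (u 0 * v 0) * oneS n + (h ⊛ C (tail (u ⊛ v))) n
        ≈⟨ +-congˡ tail-part ⟩
      (u 0 * v 0) * oneS n + ((hCu′ ⊛ C v) n + u 0 * (h ⊛ C (tail v)) n)
        ≈⟨ regroup (u 0) (v 0) (oneS n) ((hCu′ ⊛ C v) n) ((h ⊛ C (tail v)) n) ⟩
      u 0 * (v 0 * oneS n + (h ⊛ C (tail v)) n) + (hCu′ ⊛ C v) n
        ≈⟨ sym product-part ⟩
      (C u ⊛ C v) n ∎
      where
      hCu′ = h ⊛ C (tail u)
      regroup : ∀ x y d A B → (x * y) * d + (A + x * B) ≈ x * (y * d + B) + A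
      regroup x y d A B = begin
        (x * y) * d + (A + x * B) ≈⟨ +-cong (*-assoc x y d) (+-comm A (x * B)) ⟩
        x * (y * d) + (x * B + A) ≈⟨ sym (+-assoc _ _ _) ⟩
        (x * (y * d) + x * B) + A ≈⟨ +-congʳ (sym (distribˡ x _ _)) ⟩
        x * (y * d + B) + A       ∎
      tail-part : (h ⊛ C (tail (u ⊛ v))) n ≈ (hCu′ ⊛ C v) n + u 0 * (h ⊛ C (tail v)) n
      tail-part = begin
        (h ⊛ C (tail (u ⊛ v))) n
          ≈⟨ ⊛-congˡ h (≋-trans (C-cong (tail-⊛ u v)) (C-+ _ _)) n ⟩
        (h ⊛ (C (tail u ⊛ v) +ₛ C (u 0 ·ₛ tail v))) n
          ≈⟨ h⊛-below n _ _ (λ j j<n → +-cong (ih j<n (tail u) v) (C-· (u 0) (tail v) j)) ⟩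
        (h ⊛ ((C (tail u) ⊛ C v) +ₛ (u 0 ·ₛ C (tail v)))) n
          ≈⟨ ⊛-distribˡ h (C (tail u) ⊛ C v) (u 0 ·ₛ C (tail v)) n ⟩
        (h ⊛ (C (tail u) ⊛ C v)) n + (h ⊛ (u 0 ·ₛ C (tail v))) n
          ≈⟨ +-cong (≋-sym (⊛-assoc h (C (tail u)) (C v)) n) (⊛-scalʳ (u 0) h (C (tail v)) n) ⟩
        (hCu′ ⊛ C v) n + u 0 * (h ⊛ C (tail v)) n ∎
      product-part : (C u ⊛ C v) n ≈ u 0 * (v 0 * oneS n + (h ⊛ C (tail v)) n) + (hCu′ ⊛ C v) n
      product-part = begin
        (C u ⊛ C v) n
          ≈⟨ ⊛-congʳ {u′ = (u 0 ·ₛ oneS) +ₛ hCu′} (C v) (C-horner u) n ⟩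
        (((u 0 ·ₛ oneS) +ₛ hCu′) ⊛ C v) n
          ≈⟨ ⊛-distribʳ (u 0 ·ₛ oneS) hCu′ (C v) n ⟩
        ((u 0 ·ₛ oneS) ⊛ C v) n + (hCu′ ⊛ C v) n
          ≈⟨ +-congʳ (trans (⊛-scalˡ (u 0) oneS (C v) n) (*-congˡ (oneS-⊛ (C v) n))) ⟩
        u 0 * C v n + (hCu′ ⊛ C v) n
          ≈⟨ +-congʳ (*-congˡ (C-horner v n)) ⟩
        u 0 * (v 0 * oneS n + (h ⊛ C (tail v)) n) + (hCu′ ⊛ C v) n ∎

    C-mult : ∀ u v → C (u ⊛ v) ≋ (C u ⊛ C v)
    C-mult u v n = <-rec C-MultAt C-mult-step n u v

  col : PolySeq → ℕ → Series
  col s k n = s n k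

  -- The coefficients of  b(x) + x·t·S(x,t)  where  S(x,t) = Σ s n k xⁿ tᵏ.
  columnTarget : Series → PolySeq → ℕ → ℕ → K
  columnTarget b s zero    k = constP (b 0) k
  columnTarget b s (suc n) k = shiftX (s n) k + constP (b (suc n)) k

  ColumnEqs : Series → Series → PolySeq → Set ℓ
  ColumnEqs a b s = ∀ n k → (a ⊛ col s k) n ≈ columnTarget b s n k

  ColumnEqs⇒zero : ∀ a b s → ColumnEqs a b s → (a ⊛ col s 0) ≋ b
  ColumnEqs⇒zero a b s eqs zero    = eqs 0 0
  ColumnEqs⇒zero a b s eqs (suc n) = trans (eqs (suc n) 0) (+-identityˡ _)

  ColumnEqs⇒suc : ∀ a b s → ColumnEqs a b s → ∀ k → (a ⊛ col s (suc k)) ≋ (X ⊛ col s k)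
  ColumnEqs⇒suc a b s eqs k zero    = trans (eqs 0 (suc k)) (sym (X⊛-zero (col s k)))
  ColumnEqs⇒suc a b s eqs k (suc n) =
    trans (eqs (suc n) (suc k)) (trans (+-identityʳ _) (sym (X⊛-suc (col s k) n)))

  columnEqs : ∀ a b s → (a ⊛ col s 0) ≋ b → (∀ k → (a ⊛ col s (suc k)) ≋ (X ⊛ col s k)) →
              ColumnEqs a b s
  columnEqs a b s e₀ eₛ zero    zero    = e₀ 0
  columnEqs a b s e₀ eₛ (suc n) zero    = trans (e₀ (suc n)) (sym (+-identityˡ _))
  columnEqs a b s e₀ eₛ zero    (suc k) = trans (eₛ k 0) (X⊛-zero (col s k))
  columnEqs a b s e₀ eₛ (suc n) (suc k) =
    trans (eₛ k (suc n)) (trans (X⊛-suc (col s k) n) (sym (+-identityʳ _)))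

  -- For a₀ ≠ 0, the recurrence  Rec a b s  is the column system solved for
  -- the leading term  a₀ · s (n+1) k.
  module Recurrence (a b : Series) (a₀≉0 : ¬ (a 0 ≈ 0#)) (s : PolySeq) where
    ia : K
    ia = inv (a 0) a₀≉0

    ia-cancel : ∀ y → a 0 * (ia * y) ≈ y
    ia-cancel y = trans (sym (*-assoc _ _ _)) (trans (*-congʳ (inv-r (a 0) a₀≉0)) (*-identityˡ y))

    ia-unique : ∀ x y → a 0 * x ≈ y → x ≈ ia * y
    ia-unique x y e = begin
      x              ≈⟨ sym (*-identityˡ x) ⟩
      1# * x         ≈⟨ *-congʳ (sym (trans (*-comm ia (a 0)) (inv-r (a 0) a₀≉0))) ⟩
      (ia * a 0) * x ≈⟨ *-assoc _ _ _ ⟩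
      ia * (a 0 * x) ≈⟨ *-congˡ e ⟩
      ia * y         ∎

    linear-unique : ∀ x y z → a 0 * x + z ≈ y → x ≈ ia * (y - z)
    linear-unique x y z e =
      ia-unique x (y - z) (trans (sym (//-rightDividesʳ z (a 0 * x))) (+-congʳ e))

    linear-solution : ∀ x y z → x ≈ ia * (y - z) → a 0 * x + z ≈ y
    linear-solution x y z e =
      trans (+-congʳ (trans (*-congˡ e) (ia-cancel (y - z)))) (//-rightDividesˡ z y)

    constP-ia : ∀ x k → constP (x * ia) k ≈ ia * constP x k
    constP-ia x zero    = *-comm x ia
    constP-ia x (suc k) = sym (zeroʳ ia)

    module _ (n k : ℕ) where
      -- contribution of s₀, …, s_n to the coefficient of x^{n+1} in a · col s k
      lower : K
      lower = a 1 * s n k + sumLt n (λ i → a (suc (suc i)) * s (n ∸ suc i) k)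

      column-split : (a ⊛ col s k) (suc n) ≈ a 0 * s (suc n) k + lower
      column-split = trans (conv-head n (λ i j → a i * s j k))
                           (+-congˡ (sumTo-headLt n (λ j → a (suc j) * s (n ∸ j) k)))

      recurrence-rhs :
        (((shiftX (s n) k + - (a 1 * s n k)) * ia
          + - sumLt n (λ i → (a (suc (suc i)) * ia) * s (n ∸ suc i) k))
          + constP (b (suc n) * ia) k)
        ≈ ia * (columnTarget b s (suc n) k - lower)
      recurrence-rhs = begin
        ((u + - y) * ia + - sumLt n (λ i → (a (suc (suc i)) * ia) * s (n ∸ suc i) k))
          + constP (b (suc n) * ia) k
          ≈⟨ +-cong (+-congˡ (-‿cong pull-ia)) (constP-ia (b (suc n)) k) ⟩
        ((u + - y) * ia + - (ia * L)) + ia * B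
          ≈⟨ +-congʳ (+-congˡ (-‿distribʳ-* ia L)) ⟩
        ((u + - y) * ia + ia * - L) + ia * B
          ≈⟨ solve 5 (λ u ny nL B i → (((u ⊕ ny) ⊗ i ⊕ i ⊗ nL) ⊕ i ⊗ B) ⊜ (i ⊗ ((u ⊕ B) ⊕ (ny ⊕ nL))))
                     refl u (- y) (- L) B ia ⟩
        ia * ((u + B) + (- y + - L))
          ≈⟨ *-congˡ (+-congˡ (sym (neg-+ y L))) ⟩
        ia * ((u + B) - (y + L)) ∎
        where
        u = shiftX (s n) k
        y = a 1 * s n k
        L = sumLt n (λ i → a (suc (suc i)) * s (n ∸ suc i) k)
        B = constP (b (suc n)) k
        pull-ia : sumLt n (λ i → (a (suc (suc i)) * ia) * s (n ∸ suc i) k) ≈ ia * L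
        pull-ia = trans (sumLt-cong n (λ i → trans (*-congʳ (*-comm _ ia)) (*-assoc ia _ _)))
                        (sym (sumLt-*ˡ n ia _))

    Rec⇒ColumnEqs : Rec a b a₀≉0 s → ColumnEqs a b s
    Rec⇒ColumnEqs (rec₀ , recₛ) zero k =
      trans (*-congˡ (trans (rec₀ k) (constP-ia (b 0) k))) (ia-cancel _)
    Rec⇒ColumnEqs (rec₀ , recₛ) (suc n) k =
      trans (column-split n k)
            (linear-solution _ _ _ (trans (recₛ n k) (recurrence-rhs n k)))

    ColumnEqs⇒Rec : ColumnEqs a b s → Rec a b a₀≉0 s
    ColumnEqs⇒Rec eqs =
      (λ k → trans (ia-unique _ _ (eqs 0 k)) (sym (constP-ia (b 0) k))) ,
      (λ n k → trans (linear-unique _ _ _ (trans (sym (column-split n k)) (eqs (suc n) k)))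
                     (sym (recurrence-rhs n k)))

  module UmbralColumns (f g l m : Series) (g₀≉0 : ¬ (g 0 ≈ 0#)) (m₀≉0 : ¬ (m 0 ≈ 0#))
                       (p q : PolySeq) (rec-p : Rec g f g₀≉0 p) (rec-q : Rec m l m₀≉0 q) where
    open Inverse g g₀≉0 using (invS-⊛; ⊛-invS)

    h : Series
    h = xOver g g₀≉0

    open Composition h (X⊛-zero (invS g g₀≉0)) public using (C; C-cong; C-partial; C-mult; C-X)

    columns-p : ColumnEqs g f p
    columns-p = Recurrence.Rec⇒ColumnEqs g f g₀≉0 p rec-p

    columns-q : ColumnEqs m l q
    columns-q = Recurrence.Rec⇒ColumnEqs m l m₀≉0 q rec-q

    P₀ : Series
    P₀ = col p 0

    col-p : ∀ k → col p k ≋ (P₀ ⊛ powS h k)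
    col-p zero    = ≋-sym (⊛-oneS P₀)
    col-p (suc k) = S.begin
      col p (suc k)                      S.≈⟨ ≋-sym (oneS-⊛ (col p (suc k))) ⟩
      (oneS ⊛ col p (suc k))             S.≈⟨ ⊛-congʳ (col p (suc k)) (≋-sym invS-⊛) ⟩
      ((ig ⊛ g) ⊛ col p (suc k))         S.≈⟨ ⊛-assoc ig g (col p (suc k)) ⟩
      (ig ⊛ (g ⊛ col p (suc k)))         S.≈⟨ ⊛-congˡ ig (ColumnEqs⇒suc g f p columns-p k) ⟩
      (ig ⊛ (X ⊛ col p k))               S.≈⟨ ≋-sym (⊛-assoc ig X (col p k)) ⟩
      ((ig ⊛ X) ⊛ col p k)               S.≈⟨ ⊛-congʳ (col p k) (⊛-comm ig X) ⟩
      (h ⊛ col p k)                      S.≈⟨ ⊛-congˡ h (col-p k) ⟩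
      (h ⊛ (P₀ ⊛ powS h k))              S.≈⟨ ≋-sym (⊛-assoc h P₀ (powS h k)) ⟩
      ((h ⊛ P₀) ⊛ powS h k)              S.≈⟨ ⊛-congʳ (powS h k) (⊛-comm h P₀) ⟩
      ((P₀ ⊛ h) ⊛ powS h k)              S.≈⟨ ⊛-assoc P₀ h (powS h k) ⟩
      (P₀ ⊛ powS h (suc k))              S.∎
      where ig = invS g g₀≉0

    col-umbral : ∀ j → col (umbral p q) j ≋ (P₀ ⊛ C (col q j))
    col-umbral j n = sym (begin
      (P₀ ⊛ C (col q j)) n
        ≈⟨ sumTo-cong n (λ i → *-congˡ (sym (C-partial (col q j) (m∸n≤m n i)))) ⟩
      sumTo n (λ i → P₀ i * sumTo n (λ k → q k j * powS h k (n ∸ i)))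
        ≈⟨ sumTo-cong n (λ i → sumTo-*ˡ n (P₀ i) _) ⟩
      sumTo n (λ i → sumTo n (λ k → P₀ i * (q k j * powS h k (n ∸ i))))
        ≈⟨ sumTo-swap n n _ ⟩
      sumTo n (λ k → sumTo n (λ i → P₀ i * (q k j * powS h k (n ∸ i))))
        ≈⟨ sumTo-cong n (λ k → sumTo-cong n (λ i → *-exchange (P₀ i) (q k j) _)) ⟩
      sumTo n (λ k → sumTo n (λ i → q k j * (P₀ i * powS h k (n ∸ i))))
        ≈⟨ sumTo-cong n (λ k → sym (sumTo-*ˡ n (q k j) _)) ⟩
      sumTo n (λ k → q k j * (P₀ ⊛ powS h k) n)
        ≈⟨ sumTo-cong n (λ k → trans (*-congˡ (sym (col-p k n))) (*-comm _ _)) ⟩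
      umbral p q n j ∎)

    -- g P₀ = f  gives  f · (x/g) = x P₀.
    f⊛h : (f ⊛ h) ≋ (X ⊛ P₀)
    f⊛h = S.begin
      (f ⊛ h)                   S.≈⟨ ⊛-congʳ h (≋-sym (ColumnEqs⇒zero g f p columns-p)) ⟩
      ((g ⊛ P₀) ⊛ (X ⊛ ig))     S.≈⟨ ⊛-congʳ h (⊛-comm g P₀) ⟩
      ((P₀ ⊛ g) ⊛ (X ⊛ ig))     S.≈⟨ ⊛-interchange P₀ g X ig ⟩
      ((P₀ ⊛ X) ⊛ (g ⊛ ig))     S.≈⟨ ⊛-cong (⊛-comm P₀ X) ⊛-invS ⟩
      ((X ⊛ P₀) ⊛ oneS)         S.≈⟨ ⊛-oneS (X ⊛ P₀) ⟩
      (X ⊛ P₀)                  S.∎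
      where ig = invS g g₀≉0

    alpha⊛col-umbral : ∀ j → (alphaS g m g₀≉0 ⊛ col (umbral p q) j) ≋ (f ⊛ C (m ⊛ col q j))
    alpha⊛col-umbral j = S.begin
      (alphaS g m g₀≉0 ⊛ col (umbral p q) j) S.≈⟨ ⊛-congˡ (alphaS g m g₀≉0) (col-umbral j) ⟩
      ((g ⊛ C m) ⊛ (P₀ ⊛ C (col q j)))      S.≈⟨ ⊛-interchange g (C m) P₀ (C (col q j)) ⟩
      ((g ⊛ P₀) ⊛ (C m ⊛ C (col q j)))      S.≈⟨ ⊛-cong (ColumnEqs⇒zero g f p columns-p)
                                                        (≋-sym (C-mult m (col q j))) ⟩
      (f ⊛ C (m ⊛ col q j))                 S.∎

mainTheorem4 : ∀ {c ℓ} (R : CommutativeRing c ℓ) (F : IsField R) → CharZero R →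
    let open CommutativeRing R
        open FieldDefs R F
    in (f g l m : Series) (g0 : ¬ (g 0 ≈ 0#)) (m0 : ¬ (m 0 ≈ 0#))
       (p q : PolySeq) →
       Rec g f g0 p → Rec m l m0 q →
       Rec (alphaS g m g0) (betaS f g l g0) (alpha0≉0 g m g0 m0) (umbral p q)
-- The columns of r = p ♯ q satisfy the column equations for the data (α, β),
-- hence r satisfies the recurrence with data (α, β).
mainTheorem4 R F _ f g l m g₀≉0 m₀≉0 p q rec-p rec-q =
  ColumnEqs⇒Rec (columnEqs α β r column-zero column-suc)
  where
  open CommutativeRing R
  open FieldDefs R F
  open Umbral R F
  open UmbralColumns f g l m g₀≉0 m₀≉0 p q rec-p rec-q
  open Setoid seriesSetoid using () renaming (sym to ≋-sym)

  α β : Series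
  α = alphaS g m g₀≉0
  β = betaS f g l g₀≉0

  r : PolySeq
  r = umbral p q

  open Recurrence α β (alpha0≉0 g m g₀≉0 m₀≉0) r using (ColumnEqs⇒Rec)

  column-zero : (α ⊛ col r 0) ≋ β
  column-zero n = trans (alpha⊛col-umbral 0 n)
                        (⊛-congˡ f (C-cong (ColumnEqs⇒zero m l q columns-q)) n)

  column-suc : ∀ j → (α ⊛ col r (suc j)) ≋ (X ⊛ col r j)
  column-suc j = S.begin
    (α ⊛ col r (suc j))              S.≈⟨ alpha⊛col-umbral (suc j) ⟩
    (f ⊛ C (m ⊛ col q (suc j)))      S.≈⟨ ⊛-congˡ f (C-cong (ColumnEqs⇒suc m l q columns-q j)) ⟩
    (f ⊛ C (X ⊛ col q j))            S.≈⟨ ⊛-congˡ f (C-X (col q j)) ⟩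
    (f ⊛ (h ⊛ C (col q j)))          S.≈⟨ ≋-sym (⊛-assoc f h (C (col q j))) ⟩
    ((f ⊛ h) ⊛ C (col q j))          S.≈⟨ ⊛-congʳ (C (col q j)) f⊛h ⟩
    ((X ⊛ P₀) ⊛ C (col q j))         S.≈⟨ ⊛-assoc X P₀ (C (col q j)) ⟩
    (X ⊛ (P₀ ⊛ C (col q j)))         S.≈⟨ ⊛-congˡ X (≋-sym (col-umbral j)) ⟩
    (X ⊛ col r j)                    S.∎
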